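{- Let $A=\{a_1,\dots,a_n\}$ be an orthonormal basis of $V_A=\mathbb{R}^n$, let $S$ be a two-dimensional real vector space with basis $\{\top,\bot\}$, and suppose the non-empty sets $C_1,\dots,C_k$ partition $A$, with $m_j=|C_j|$. Let $C=\{c_1,\dots,c_k\}$ be an orthonormal basis of $V_C=\mathbb{R}^k$ and for a predicate $p$ on $A$ define $\mathcal{J}_C(p)=\sum_{j=1}^k (n_{pC_j}/m_j)\,c_j$, where $n_{pC_j}$ is the number of $a\in C_j$ with $p(a)=\top$. Let $p,q$ be predicates on $A$ and let $\vec 1=\sum_{j=1}^k c_j$. Then: (1) $\mathcal{J}_C(\mathrm{not}\circ p)=\neg\mathcal{J}_C(p)$. (2) If $\mathcal{J}_C(p)\rightarrow\mathcal{J}_C(q)=\vec 1$, then $\mathrm{ifthen}\circ\langle p,q\rangle=\mathrm{true}$. (3) If one of $\mathcal{J}_C(q)$, $\mathcal{J}_C(p)$ is an algebraic consequence of the other (i.e. $\mathcal{J}_C(p)\rightarrow\mathcal{J}_C(q)=\vec 1$ or $\mathcal{J}_C(q)\rightarrow\mathcal{J}_C(p)=\vec 1$), then $\mathcal{J}_C(p)\wedge\mathcal{J}_C(q)=\mathcal{J}_C(\mathrm{and}\circ\langle p,q\rangle)$, $\mathcal{J}_C(p)\vee\mathcal{J}_C(q)=\mathcal{J}_C(\mathrm{or}\circ\langle p,q\rangle)$, $\mathcal{J}_C(p)\rightarrow\mathcal{J}_C(q)=\mathcal{J}_C(\mathrm{ifthen}\circ\langle p,q\rangle)$, and $\mathcal{J}_C(q)\rightarrow\mathcal{J}_C(p)=\mathcal{J}_C(\mathrm{ifthen}\circ\langle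 q,p\rangle)$.
   Context: A predicate on $A$ is a linear map $p:V_A\to S$ with $p(a)\in\{\top,\bot\}$ for every $a\in A$; $\mathrm{true}:V_A\to S$ is the predicate with $\mathrm{true}(a_i)=\top$ for all $i$. The logical connectives are the linear maps $\mathrm{not}:S\to S$ with $\mathrm{not}(\top)=\bot$, $\mathrm{not}(\bot)=\top$, and $\mathrm{and},\mathrm{or},\mathrm{ifthen}:S\otimes S\to S$ given on basis vectors by: $\mathrm{and}(z)=\top$ iff $z=\top\otimes\top$, else $\bot$; $\mathrm{or}(z)=\bot$ iff $z=\bot\otimes\bot$, else $\top$; $\mathrm{ifthen}(z)=\bot$ iff $z=\top\otimes\bot$, else $\top$. With $d_A:V_A\to V_A\otimes V_A$ the linear map $d_A(a_i)=a_i\otimes a_i$, set $\langle p,q\rangle=(p\otimes q)\circ d_A$. The algebraic connectives on scalars are $\neg\alpha=1-\alpha$, $\alpha\wedge\beta=\alpha\beta$, $\alpha\vee\beta=\alpha+\beta-\alpha\beta$, $\alpha\rightarrow\beta=1-\alpha+\alpha\beta$, applied to vectors of $V_C$ coordinatewise with respect to $C$. A vector $Y$ is an algebraic consequence of $X$ if $X\rightarrow Y=\vec 1$.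
   Formalization: The space $V_C$ is taken over the rationals, its vectors having rational coordinates with respect to $C$, in place of $V_C=\mathbb{R}^k$. -}

module Defs where

open import Data.Nat using (ℕ; zero; suc; _+_; _>_; z<s; s≤s; z≤n; >-nonZero)
open import Data.Nat.Properties using (m≤n⇒m≤o+n)
open import Data.Integer using (+_)
open import Data.Fin using (Fin; zero; suc; _≟_)
open import Data.Bool using (Bool; true; false; if_then_else_; not)
open import Data.Product using (Σ; _,_; _×_; ∃)
open import Data.Rational using (ℚ; _/_; 1ℚ; _-_; _*_) renaming (_+_ to _+ℚ_)
open import Relation.Nullary using (yes; no)
open import Relation.Binary.PropositionalEquality using (_≡_; refl)

-- The space S has basis {⊤,⊥}; we encode ⊤ as true and ⊥ as false.
-- A predicate p : V_A → S is a linear map sending each basis vector a_i to ⊤ or ⊥;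
-- such a linear map is determined by (and determines) its values on the basis
-- A = {a_0,…,a_{n-1}}, so we represent it by that function.
Pred : ℕ → Set
Pred n = Fin n → Bool

truePred : ∀ {n} → Pred n
truePred _ = true

-- logical connectives as linear maps, given on basis vectors
notS : Bool → Bool
notS true  = false
notS false = true

-- on basis vectors z = x ⊗ y of S ⊗ S
andS : Bool × Bool → Bool
andS (true , true) = true
andS _             = false

orS : Bool × Bool → Bool
orS (false , false) = false
orS _               = true

ifthenS : Bool × Bool → Bool
ifthenS (true , false) = false
ifthenS _              = true

_∘S_ : ∀ {n} → (Bool → Bool) → Pred n → Pred n
(f ∘S p) i = f (p i)

-- ⟨p,q⟩ = (p ⊗ q) ∘ d_A : sends a_i to p(a_i) ⊗ q(a_i)
⟨_,_⟩ : ∀ {n} → Pred n → Pred n → Fin n → Bool × Bool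
⟨ p , q ⟩ i = (p i , q i)

_∘₂_ : ∀ {n} → (Bool × Bool → Bool) → (Fin n → Bool × Bool) → Pred n
(f ∘₂ r) i = f (r i)

count : (n : ℕ) → (Fin n → Bool) → ℕ
count zero    f = 0
count (suc n) f = (if f zero then 1 else 0) + count n (λ i → f (suc i))

count-pos : ∀ n (f : Fin n → Bool) (i : Fin n) → f i ≡ true → count n f > 0
count-pos (suc n) f zero    eq with f zero
... | true = s≤s z≤n
count-pos (suc n) f zero () | false
count-pos (suc n) f (suc i) eq =
  m≤n⇒m≤o+n (if f zero then 1 else 0) (count-pos n (λ j → f (suc j)) i eq)

-- A partition of A into k non-empty blocks C_1,…,C_k is given by the
-- block-assignment cls : Fin n → Fin k, surjective (blocks non-empty).
Surjective : ∀ {n k} → (Fin n → Fin k) → Set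
Surjective {n} {k} cls = ∀ (j : Fin k) → ∃ λ (i : Fin n) → cls i ≡ j

inBlock : ∀ {n k} → (Fin n → Fin k) → Fin k → Fin n → Bool
inBlock cls j i with cls i ≟ j
... | yes _ = true
... | no  _ = false

blockSize : ∀ {n k} → (Fin n → Fin k) → Fin k → ℕ
blockSize {n} cls j = count n (inBlock cls j)

countIn : ∀ {n k} → (Fin n → Fin k) → Pred n → Fin k → ℕ
countIn {n} cls p j = count n (λ i → if inBlock cls j i then p i else false)

blockSize-pos : ∀ {n k} (cls : Fin n → Fin k) → Surjective cls →
                ∀ j → blockSize cls j > 0
blockSize-pos {n} cls surj j with surj j
... | i , eq = count-pos n (inBlock cls j) i (lemma eq)
  where
  lemma : cls i ≡ j → inBlock cls j i ≡ true
  lemma e with cls i ≟ j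
  ... | yes _ = refl
  ... | no ne = Data.Empty.⊥-elim (ne e)
    where import Data.Empty

-- vectors of V_C = ℝ^k in coordinates w.r.t. C; all relevant coordinates are rational
VecC : ℕ → Set
VecC k = Fin k → ℚ

J : ∀ {n k} (cls : Fin n → Fin k) → Surjective cls → Pred n → VecC k
J cls surj p j = _/_ (+ countIn cls p j) (blockSize cls j)
                   {{ >-nonZero (blockSize-pos cls surj j) }}

¬ₐ_ : ℚ → ℚ
¬ₐ α = 1ℚ - α

_∧ₐ_ : ℚ → ℚ → ℚ
α ∧ₐ β = α * β

_∨ₐ_ : ℚ → ℚ → ℚ
α ∨ₐ β = (α +ℚ β) - (α * β)

_⇒ₐ_ : ℚ → ℚ → ℚ
α ⇒ₐ β = (1ℚ - α) +ℚ (α * β)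

¬ᵥ_ : ∀ {k} → VecC k → VecC k
(¬ᵥ X) j = ¬ₐ (X j)

_∧ᵥ_ _∨ᵥ_ _⇒ᵥ_ : ∀ {k} → VecC k → VecC k → VecC k
(X ∧ᵥ Y) j = X j ∧ₐ Y j
(X ∨ᵥ Y) j = X j ∨ₐ Y j
(X ⇒ᵥ Y) j = X j ⇒ₐ Y j

one : ∀ {k} → VecC k
one _ = 1ℚ

_≈ᵥ_ : ∀ {k} → VecC k → VecC k → Set
_≈ᵥ_ {k} X Y = ∀ (j : Fin k) → X j ≡ Y j

_≈ₚ_ : ∀ {n} → Pred n → Pred n → Set
_≈ₚ_ {n} p q = ∀ (i : Fin n) → p i ≡ q i

AlgCons : ∀ {k} → VecC k → VecC k → Set
AlgCons X Y = (X ⇒ᵥ Y) ≈ᵥ one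

-- On each block C_j, J_C(p) is the proportion μ p of the block on which p holds, so
-- μ (not ∘ p) = 1 − μ p because p and not ∘ p split the block.  As x ⇒ₐ y = 1 − x (1 − y),
-- the hypothesis μ p ⇒ₐ μ q = 1 forces μ p = 0 or μ q = 1: p vanishes on the block or q
-- holds throughout it.  Then every connective applied to p and q agrees on the block with a
-- constant, p, q or not ∘ q, and the algebraic connectives take the matching values at 0 and 1.
-- In particular μ (ifthen ∘ ⟨p,q⟩) = 1, so ifthen ∘ ⟨p,q⟩ is true on the block, which gives (2).
-- The converse hypothesis reduces to this case by commutativity of ∧ and ∨.

module Submission where

open import Defs
open import Data.Bool using (Bool; true; false; if_then_else_)
open import Data.Fin as Fin using (Fin; zero; suc)
open import Data.Integer as ℤ using (+_)
import Data.Integer.Properties as ℤ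
open import Data.Integer.Solver using (module +-*-Solver)
open import Data.Nat as ℕ using (ℕ; zero; suc; NonZero; >-nonZero)
import Data.Nat.Properties as ℕ
open import Function using (_∘_; _$_)
open import Data.Product using (_×_; _,_)
open import Data.Sum using (_⊎_; inj₁; inj₂; [_,_]′)
import Data.Sum as Sum
open import Data.Rational using (ℚ; _/_; 0ℚ; 1ℚ; _+_; _*_; _-_; 1/_; ≢-nonZero; toℚᵘ)
open import Data.Rational.Properties
  using (_≟_; *-identityˡ; *-identityʳ; *-inverseˡ; *-assoc; *-zeroˡ; *-zeroʳ; *-comm; 0/n≡0;
         toℚᵘ-injective; toℚᵘ-homo-+; toℚᵘ-fromℚᵘ; fromℚᵘ-cong; fromℚᵘ-injective)
open import Data.Rational.Solver using () renaming (module +-*-Solver to ℚ-Solver)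
open import Data.Rational.Unnormalised as ℚᵘ using (mkℚᵘ; *≡*)
import Data.Rational.Unnormalised.Properties as ℚᵘ
open import Relation.Nullary using (yes; no; contradiction)
open import Relation.Binary.PropositionalEquality hiding (J)

x*y≡0⇒x≡0⊎y≡0 : ∀ x y → x * y ≡ 0ℚ → x ≡ 0ℚ ⊎ y ≡ 0ℚ
x*y≡0⇒x≡0⊎y≡0 x y xy≡0 with x ≟ 0ℚ
... | yes x≡0 = inj₁ x≡0
... | no  x≢0 = inj₂ (begin
  y              ≡⟨ *-identityˡ y ⟨
  1ℚ * y         ≡⟨ cong (_* y) (*-inverseˡ x) ⟨
  (1/ x * x) * y ≡⟨ *-assoc (1/ x) x y ⟩
  1/ x * (x * y) ≡⟨ cong (1/ x *_) xy≡0 ⟩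
  1/ x * 0ℚ      ≡⟨ *-zeroʳ (1/ x) ⟩
  0ℚ             ∎)
  where
  open ≡-Reasoning
  instance _ = ≢-nonZero x≢0

/-+ : ∀ a b m .{{_ : NonZero m}} → + a / m + + b / m ≡ + (a ℕ.+ b) / m
/-+ a b m@(suc m-1) = toℚᵘ-injective (begin-equality
  toℚᵘ (+ a / m + + b / m)                    ≃⟨ toℚᵘ-homo-+ (+ a / m) (+ b / m) ⟩
  toℚᵘ (+ a / m) ℚᵘ.+ toℚᵘ (+ b / m)          ≃⟨ ℚᵘ.+-cong (toℚᵘ-fromℚᵘ (mkℚᵘ (+ a) m-1)) (toℚᵘ-fromℚᵘ (mkℚᵘ (+ b) m-1)) ⟩
  mkℚᵘ (+ a) m-1 ℚᵘ.+ mkℚᵘ (+ b) m-1          ≃⟨ *≡* cross-multiplied ⟩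
  mkℚᵘ (+ (a ℕ.+ b)) m-1                      ≃⟨ toℚᵘ-fromℚᵘ (mkℚᵘ (+ (a ℕ.+ b)) m-1) ⟨
  toℚᵘ (+ (a ℕ.+ b) / m)                      ∎)
  where
  open ℚᵘ.≤-Reasoning
  cross-multiplied : (+ a ℤ.* + m ℤ.+ + b ℤ.* + m) ℤ.* + m ≡ + (a ℕ.+ b) ℤ.* + (m ℕ.* m)
  cross-multiplied rewrite ℤ.pos-+ a b | ℤ.pos-* m m =
    solve 3 (λ a b m → (a :* m :+ b :* m) :* m := (a :+ b) :* (m :* m)) refl (+ a) (+ b) (+ m)
    where open +-*-Solver

/-injectiveˡ : ∀ a b m .{{_ : NonZero m}} → + a / m ≡ + b / m → a ≡ b
/-injectiveˡ a b m@(suc m-1) a/m≡b/m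
  with *≡* a*m≡b*m ← fromℚᵘ-injective {mkℚᵘ (+ a) m-1} {mkℚᵘ (+ b) m-1} a/m≡b/m =
  ℤ.+-injective (ℤ.*-cancelʳ-≡ (+ a) (+ b) (+ m) a*m≡b*m)

n/n≡1 : ∀ m .{{_ : NonZero m}} → + m / m ≡ 1ℚ
n/n≡1 m@(suc m-1) = fromℚᵘ-cong {mkℚᵘ (+ m) m-1} {mkℚᵘ (+ 1) 0} (*≡* (ℤ.*-comm (+ m) (+ 1)))

module _ where
  open ℚ-Solver

  0∨ₐy≡y : ∀ y → 0ℚ ∨ₐ y ≡ y
  0∨ₐy≡y = solve 1 (λ y → (con 0ℚ :+ y) :- con 0ℚ :* y := y) refl

  0⇒ₐy≡1 : ∀ y → 0ℚ ⇒ₐ y ≡ 1ℚ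
  0⇒ₐy≡1 = solve 1 (λ y → (con 1ℚ :- con 0ℚ) :+ con 0ℚ :* y := con 1ℚ) refl

  y⇒ₐ0≡¬ₐy : ∀ y → y ⇒ₐ 0ℚ ≡ ¬ₐ y
  y⇒ₐ0≡¬ₐy = solve 1 (λ y → (con 1ℚ :- y) :+ y :* con 0ℚ := con 1ℚ :- y) refl

  x∨ₐ1≡1 : ∀ x → x ∨ₐ 1ℚ ≡ 1ℚ
  x∨ₐ1≡1 = solve 1 (λ x → (x :+ con 1ℚ) :- x :* con 1ℚ := con 1ℚ) refl

  x⇒ₐ1≡1 : ∀ x → x ⇒ₐ 1ℚ ≡ 1ℚ
  x⇒ₐ1≡1 = solve 1 (λ x → (con 1ℚ :- x) :+ x :* con 1ℚ := con 1ℚ) refl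

  1⇒ₐx≡x : ∀ x → 1ℚ ⇒ₐ x ≡ x
  1⇒ₐx≡x = solve 1 (λ x → (con 1ℚ :- con 1ℚ) :+ con 1ℚ :* x := x) refl

  ∨ₐ-comm : ∀ x y → x ∨ₐ y ≡ y ∨ₐ x
  ∨ₐ-comm = solve 2 (λ x y → (x :+ y) :- x :* y := (y :+ x) :- y :* x) refl

  ¬ₐx≡0⇒x≡1 : ∀ x → ¬ₐ x ≡ 0ℚ → x ≡ 1ℚ
  ¬ₐx≡0⇒x≡1 x 1-x≡0 = begin
    x              ≡⟨ solve 1 (λ x → x := con 1ℚ :- (con 1ℚ :- x)) refl x ⟩
    1ℚ - (1ℚ - x)  ≡⟨ cong ¬ₐ_ 1-x≡0 ⟩
    1ℚ - 0ℚ        ≡⟨⟩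
    1ℚ             ∎
    where open ≡-Reasoning

  x⇒ₐy≡1⇒x≡0⊎y≡1 : ∀ x y → x ⇒ₐ y ≡ 1ℚ → x ≡ 0ℚ ⊎ y ≡ 1ℚ
  x⇒ₐy≡1⇒x≡0⊎y≡1 x y x⇒y≡1 =
    Sum.map₂ (¬ₐx≡0⇒x≡1 y) (x*y≡0⇒x≡0⊎y≡0 x (¬ₐ y) x*[1-y]≡0)
    where
    open ≡-Reasoning
    x*[1-y]≡0 : x * (¬ₐ y) ≡ 0ℚ
    x*[1-y]≡0 = begin
      x * (1ℚ - y)      ≡⟨ solve 2 (λ x y → x :* (con 1ℚ :- y) := con 1ℚ :- ((con 1ℚ :- x) :+ x :* y)) refl x y ⟩
      1ℚ - (x ⇒ₐ y)     ≡⟨ cong ¬ₐ_ x⇒y≡1 ⟩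
      1ℚ - 1ℚ           ≡⟨⟩
      0ℚ                ∎

notS≡false⇒true : ∀ {a} → notS a ≡ false → a ≡ true
notS≡false⇒true {true} _ = refl

andS-falseˡ : ∀ {a} b → a ≡ false → andS (a , b) ≡ a
andS-falseˡ b refl = refl

ifthenS-falseˡ : ∀ {a} b → a ≡ false → ifthenS (a , b) ≡ true
ifthenS-falseˡ b refl = refl

andS-trueʳ : ∀ a {b} → b ≡ true → andS (a , b) ≡ a
andS-trueʳ false refl = refl
andS-trueʳ true  refl = refl

orS-falseˡ : ∀ {a} b → a ≡ false → orS (a , b) ≡ b
orS-falseˡ false refl = refl
orS-falseˡ true  refl = refl

orS-trueʳ : ∀ a {b} → b ≡ true → orS (a , b) ≡ true
orS-trueʳ false refl = refl
orS-trueʳ true  refl = refl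

ifthenS-trueʳ : ∀ a {b} → b ≡ true → ifthenS (a , b) ≡ true
ifthenS-trueʳ false refl = refl
ifthenS-trueʳ true  refl = refl

ifthenS-trueˡ : ∀ {a} b → a ≡ true → ifthenS (a , b) ≡ b
ifthenS-trueˡ false refl = refl
ifthenS-trueˡ true  refl = refl

ifthenS-falseʳ : ∀ a {b} → b ≡ false → ifthenS (a , b) ≡ notS a
ifthenS-falseʳ false refl = refl
ifthenS-falseʳ true  refl = refl

andS-comm : ∀ a b → andS (a , b) ≡ andS (b , a)
andS-comm false false = refl
andS-comm false true  = refl
andS-comm true  false = refl
andS-comm true  true  = refl

orS-comm : ∀ a b → orS (a , b) ≡ orS (b , a)
orS-comm false false = refl
orS-comm false true  = refl
orS-comm true  false = refl
orS-comm true  true  = refl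

count-cong : ∀ n {g h : Fin n → Bool} → g ≗ h → count n g ≡ count n h
count-cong zero    g≗h = refl
count-cong (suc n) g≗h =
  cong₂ ℕ._+_ (cong (λ b → if b then 1 else 0) (g≗h zero)) (count-cong n (g≗h ∘ suc))

countOn : ∀ {n} → (Fin n → Bool) → (Fin n → Bool) → ℕ
countOn {n} f g = count n (λ i → if f i then g i else false)

countOn-cong : ∀ {n} (f : Fin n → Bool) {g h} →
               (∀ i → f i ≡ true → g i ≡ h i) → countOn f g ≡ countOn f h
countOn-cong {n} f {g} {h} g≡h = count-cong n restricted
  where
  restricted : ∀ i → (if f i then g i else false) ≡ (if f i then h i else false)
  restricted i with f i in fi
  ... | true  = g≡h i fi
  ... | false = refl

countOn-true : ∀ {n} (f : Fin n → Bool) → countOn f (λ _ → true) ≡ count n f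
countOn-true {n} f = count-cong n if-true
  where
  if-true : ∀ i → (if f i then true else false) ≡ f i
  if-true i with f i
  ... | true  = refl
  ... | false = refl

countOn-+-not : ∀ {n} (f g : Fin n → Bool) → countOn f g ℕ.+ countOn f (notS ∘S g) ≡ count n f
countOn-+-not {zero}  f g = refl
countOn-+-not {suc n} f g with f zero | g zero | countOn-+-not (λ i → f (suc i)) (λ i → g (suc i))
... | true  | true  | ih = cong suc ih
... | true  | false | ih = trans (ℕ.+-suc _ _) (cong suc ih)
... | false | _     | ih = ih

countOn≡0⇒false : ∀ {n} (f g : Fin n → Bool) → countOn f g ≡ 0 → ∀ i → f i ≡ true → g i ≡ false
countOn≡0⇒false {suc n} f g c≡0 zero fi with f zero | g zero
countOn≡0⇒false {suc n} f g ()  zero refl | true  | true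
... | true  | false = refl
countOn≡0⇒false {suc n} f g c≡0 zero ()   | false | _
countOn≡0⇒false {suc n} f g c≡0 (suc i) fi with f zero | g zero
countOn≡0⇒false {suc n} f g ()  (suc i) fi | true  | true
... | true  | false = countOn≡0⇒false (λ i → f (suc i)) (λ i → g (suc i)) c≡0 i fi
... | false | _     = countOn≡0⇒false (λ i → f (suc i)) (λ i → g (suc i)) c≡0 i fi

module Block {n} (f : Fin n → Bool) .{{_ : NonZero (count n f)}} where

  μ : (Fin n → Bool) → ℚ
  μ g = + countOn f g / count n f

  μ-cong : ∀ {g h} → (∀ i → f i ≡ true → g i ≡ h i) → μ g ≡ μ h
  μ-cong g≡h = cong (λ c → + c / count n f) (countOn-cong f g≡h)

  μ-true : μ (λ _ → true) ≡ 1ℚ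
  μ-true = trans (cong (λ c → + c / count n f) (countOn-true f)) (n/n≡1 (count n f))

  μ-not : ∀ g → μ (notS ∘S g) ≡ ¬ₐ μ g
  μ-not g = begin
    μ (notS ∘S g)                 ≡⟨ solve 2 (λ x y → y := (x :+ y) :- x) refl (μ g) (μ (notS ∘S g)) ⟩
    (μ g + μ (notS ∘S g)) - μ g   ≡⟨ cong (_- μ g) (/-+ (countOn f g) (countOn f (notS ∘S g)) (count n f)) ⟩
    + (countOn f g ℕ.+ countOn f (notS ∘S g)) / count n f - μ g
                                  ≡⟨ cong (λ c → + c / count n f - μ g) (countOn-+-not f g) ⟩
    + count n f / count n f - μ g ≡⟨ cong (_- μ g) (n/n≡1 (count n f)) ⟩
    ¬ₐ μ g                        ∎
    where
    open ≡-Reasoning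
    open ℚ-Solver

  μ≡0⇒false : ∀ g → μ g ≡ 0ℚ → ∀ i → f i ≡ true → g i ≡ false
  μ≡0⇒false g μg≡0 = countOn≡0⇒false f g
    (/-injectiveˡ (countOn f g) 0 (count n f) (trans μg≡0 (sym (0/n≡0 (count n f)))))

  μ≡1⇒true : ∀ g → μ g ≡ 1ℚ → ∀ i → f i ≡ true → g i ≡ true
  μ≡1⇒true g μg≡1 i fi = notS≡false⇒true (μ≡0⇒false (notS ∘S g) μ[¬g]≡0 i fi)
    where
    μ[¬g]≡0 : μ (notS ∘S g) ≡ 0ℚ
    μ[¬g]≡0 = trans (μ-not g) (cong ¬ₐ_ μg≡1)

  record Homomorphic (p q : Fin n → Bool) : Set where
    field
      ∧-homo : μ p ∧ₐ μ q ≡ μ (andS ∘₂ ⟨ p , q ⟩)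
      ∨-homo : μ p ∨ₐ μ q ≡ μ (orS ∘₂ ⟨ p , q ⟩)
      ⇒-homo : μ p ⇒ₐ μ q ≡ μ (ifthenS ∘₂ ⟨ p , q ⟩)
      ⇐-homo : μ q ⇒ₐ μ p ≡ μ (ifthenS ∘₂ ⟨ q , p ⟩)

  open Homomorphic public

  homomorphic-if-vanishing : ∀ p q → μ p ≡ 0ℚ → Homomorphic p q
  homomorphic-if-vanishing p q μp≡0 = record
    { ∧-homo = begin
        μ p ∧ₐ μ q             ≡⟨ cong (_∧ₐ μ q) μp≡0 ⟩
        0ℚ ∧ₐ μ q              ≡⟨ *-zeroˡ (μ q) ⟩
        0ℚ                     ≡⟨ μp≡0 ⟨
        μ p                    ≡⟨ on-block (λ i → andS-falseˡ (q i)) ⟨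
        μ (andS ∘₂ ⟨ p , q ⟩)  ∎
    ; ∨-homo = begin
        μ p ∨ₐ μ q             ≡⟨ cong (_∨ₐ μ q) μp≡0 ⟩
        0ℚ ∨ₐ μ q              ≡⟨ 0∨ₐy≡y (μ q) ⟩
        μ q                    ≡⟨ on-block (λ i → orS-falseˡ (q i)) ⟨
        μ (orS ∘₂ ⟨ p , q ⟩)   ∎
    ; ⇒-homo = begin
        μ p ⇒ₐ μ q                ≡⟨ cong (_⇒ₐ μ q) μp≡0 ⟩
        0ℚ ⇒ₐ μ q                 ≡⟨ 0⇒ₐy≡1 (μ q) ⟩
        1ℚ                        ≡⟨ μ-true ⟨
        μ (λ _ → true)            ≡⟨ on-block (λ i → ifthenS-falseˡ (q i)) ⟨
        μ (ifthenS ∘₂ ⟨ p , q ⟩)  ∎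
    ; ⇐-homo = begin
        μ q ⇒ₐ μ p                ≡⟨ cong (μ q ⇒ₐ_) μp≡0 ⟩
        μ q ⇒ₐ 0ℚ                 ≡⟨ y⇒ₐ0≡¬ₐy (μ q) ⟩
        ¬ₐ μ q                    ≡⟨ μ-not q ⟨
        μ (notS ∘S q)             ≡⟨ on-block (λ i → ifthenS-falseʳ (q i)) ⟨
        μ (ifthenS ∘₂ ⟨ q , p ⟩)  ∎
    }
    where
    open ≡-Reasoning
    on-block : ∀ {g h} → (∀ i → p i ≡ false → g i ≡ h i) → μ g ≡ μ h
    on-block g≡h = μ-cong λ i fi → g≡h i (μ≡0⇒false p μp≡0 i fi)

  homomorphic-if-full : ∀ p q → μ q ≡ 1ℚ → Homomorphic p q
  homomorphic-if-full p q μq≡1 = record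
    { ∧-homo = begin
        μ p ∧ₐ μ q             ≡⟨ cong (μ p ∧ₐ_) μq≡1 ⟩
        μ p ∧ₐ 1ℚ              ≡⟨ *-identityʳ (μ p) ⟩
        μ p                    ≡⟨ on-block (λ i → andS-trueʳ (p i)) ⟨
        μ (andS ∘₂ ⟨ p , q ⟩)  ∎
    ; ∨-homo = begin
        μ p ∨ₐ μ q             ≡⟨ cong (μ p ∨ₐ_) μq≡1 ⟩
        μ p ∨ₐ 1ℚ              ≡⟨ x∨ₐ1≡1 (μ p) ⟩
        1ℚ                     ≡⟨ μ-true ⟨
        μ (λ _ → true)         ≡⟨ on-block (λ i → orS-trueʳ (p i)) ⟨
        μ (orS ∘₂ ⟨ p , q ⟩)   ∎
    ; ⇒-homo = begin
        μ p ⇒ₐ μ q                ≡⟨ cong (μ p ⇒ₐ_) μq≡1 ⟩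
        μ p ⇒ₐ 1ℚ                 ≡⟨ x⇒ₐ1≡1 (μ p) ⟩
        1ℚ                        ≡⟨ μ-true ⟨
        μ (λ _ → true)            ≡⟨ on-block (λ i → ifthenS-trueʳ (p i)) ⟨
        μ (ifthenS ∘₂ ⟨ p , q ⟩)  ∎
    ; ⇐-homo = begin
        μ q ⇒ₐ μ p                ≡⟨ cong (_⇒ₐ μ p) μq≡1 ⟩
        1ℚ ⇒ₐ μ p                 ≡⟨ 1⇒ₐx≡x (μ p) ⟩
        μ p                       ≡⟨ on-block (λ i → ifthenS-trueˡ (p i)) ⟨
        μ (ifthenS ∘₂ ⟨ q , p ⟩)  ∎
    }
    where
    open ≡-Reasoning
    on-block : ∀ {g h} → (∀ i → q i ≡ true → g i ≡ h i) → μ g ≡ μ h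
    on-block g≡h = μ-cong λ i fi → g≡h i (μ≡1⇒true q μq≡1 i fi)

  homomorphic-sym : ∀ p q → Homomorphic q p → Homomorphic p q
  homomorphic-sym p q hom = record
    { ∧-homo = trans (*-comm (μ p) (μ q)) (trans (∧-homo hom) (μ-cong λ i _ → andS-comm (q i) (p i)))
    ; ∨-homo = trans (∨ₐ-comm (μ p) (μ q)) (trans (∨-homo hom) (μ-cong λ i _ → orS-comm (q i) (p i)))
    ; ⇒-homo = ⇐-homo hom
    ; ⇐-homo = ⇒-homo hom
    }

  homomorphic-if-⇒ₐ≡1 : ∀ p q → μ p ⇒ₐ μ q ≡ 1ℚ → Homomorphic p q
  homomorphic-if-⇒ₐ≡1 p q =
    [ homomorphic-if-vanishing p q , homomorphic-if-full p q ]′ ∘ x⇒ₐy≡1⇒x≡0⊎y≡1 (μ p) (μ q)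

  homomorphic : ∀ p q → μ p ⇒ₐ μ q ≡ 1ℚ ⊎ μ q ⇒ₐ μ p ≡ 1ℚ → Homomorphic p q
  homomorphic p q = [ homomorphic-if-⇒ₐ≡1 p q , homomorphic-sym p q ∘ homomorphic-if-⇒ₐ≡1 q p ]′

  ifthenS-true : ∀ p q → μ p ⇒ₐ μ q ≡ 1ℚ → ∀ i → f i ≡ true → ifthenS (p i , q i) ≡ true
  ifthenS-true p q μp⇒μq≡1 =
    μ≡1⇒true (ifthenS ∘₂ ⟨ p , q ⟩) (trans (sym (⇒-homo (homomorphic-if-⇒ₐ≡1 p q μp⇒μq≡1))) μp⇒μq≡1)

inBlock-self : ∀ {n k} (cls : Fin n → Fin k) i → inBlock cls (cls i) i ≡ true
inBlock-self cls i with cls i Fin.≟ cls i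
... | yes _  = refl
... | no cls-i≢cls-i = contradiction refl cls-i≢cls-i

theorem1 : ∀ (n k : ℕ) (cls : Fin n → Fin k) (surj : Surjective cls) (p q : Pred n) →
    (J cls surj (notS ∘S p) ≈ᵥ (¬ᵥ J cls surj p))
    × (((J cls surj p ⇒ᵥ J cls surj q) ≈ᵥ one) → (ifthenS ∘₂ ⟨ p , q ⟩) ≈ₚ truePred)
    × ((AlgCons (J cls surj p) (J cls surj q) ⊎ AlgCons (J cls surj q) (J cls surj p)) →
        ((J cls surj p ∧ᵥ J cls surj q) ≈ᵥ J cls surj (andS ∘₂ ⟨ p , q ⟩))
        × ((J cls surj p ∨ᵥ J cls surj q) ≈ᵥ J cls surj (orS ∘₂ ⟨ p , q ⟩))
        × ((J cls surj p ⇒ᵥ J cls surj q) ≈ᵥ J cls surj (ifthenS ∘₂ ⟨ p , q ⟩))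
        × ((J cls surj q ⇒ᵥ J cls surj p) ≈ᵥ J cls surj (ifthenS ∘₂ ⟨ q , p ⟩)))
theorem1 n k cls surj p q =
    (λ j → B.μ-not j p)
  , (λ J[p⇒q]≡1 i → B.ifthenS-true (cls i) p q (J[p⇒q]≡1 (cls i)) i (inBlock-self cls i))
  , λ cons → (λ j → B.∧-homo (hom cons j)) , (λ j → B.∨-homo (hom cons j))
           , (λ j → B.⇒-homo (hom cons j)) , (λ j → B.⇐-homo (hom cons j))
  where
  module B (j : Fin k) = Block (inBlock cls j) {{ >-nonZero (blockSize-pos cls surj j) }}

  hom : AlgCons (J cls surj p) (J cls surj q) ⊎ AlgCons (J cls surj q) (J cls surj p) →
        ∀ j → B.Homomorphic j p q
  hom cons j = B.homomorphic j p q (Sum.map (_$ j) (_$ j) cons)
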